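{- $$\sum_{r=0}^\infty\frac{Q^*_{(r)}(x_1,x_2,\dots)}{(u\downarrow r)}=\prod_{i=1}^\infty\frac{u+1+x_i}{u+1-x_i},$$ as an identity of formal power series in $u^{ -1}$ with coefficients in $\Gamma$ (equivalently, for every $n$, after setting $x_i=0$ for $i>n$).
   Context: $\Gamma$ is the algebra of supersymmetric functions: sequences $(f_m)_{m\ge1}$ of supersymmetric polynomials (symmetric, and independent of $t$ after substituting $x_i=t,x_j=-t$) with $f_{m+1}(x_1,\dots,x_m,0)=f_m$ and bounded degrees. Put $(x\downarrow k)=\prod_{m=1}^k(x-m+1)$, $(x\downarrow0)=1$. For $r\ge1$, $P^*_{(r)}(x_1,\dots,x_m)=\frac1{(m-1)!}\sum_{\omega\in S(m)}(x_{\omega(1)}\downarrow r)\prod_{1<j\le m}\frac{x_{\omega(1)}+x_{\omega(j)}}{x_{\omega(1)}-x_{\omega(j)}}$ defines $P^*_{(r)}\in\Gamma$; $Q^*_{(r)}=2P^*_{(r)}$ for $r\ge1$, $Q^*_{(0)}=1$. Each $1/(u\downarrow r)$ and each factor on the right is expanded in powers of $u^{ -1}$. -}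

module Defs where

open import Data.Nat as ℕ using (ℕ; zero; suc; _∸_; _!)

open import Data.Fin using (Fin)
open import Data.List using (List; []; _∷_; map; foldr; upTo; allFin; concatMap)
open import Data.Rational using (ℚ; 0ℚ; 1ℚ; _+_; _*_; _-_; 1/_; ≢-nonZero)
import Data.Rational as ℚ
open import Data.Rational.Properties using (_≟_)
open import Relation.Nullary using (yes; no)

ι : ℕ → ℚ
ι n = ℚ._/_ (ℤ+ n) 1
  where open import Data.Integer using () renaming (+_ to ℤ+)

-- total reciprocal (only ever applied to nonzero arguments below)
inv : ℚ → ℚ
inv q with q ≟ 0ℚ
... | yes _ = 0ℚ
... | no q≢0 = 1/_ q {{≢-nonZero q≢0}}

_÷'_ : ℚ → ℚ → ℚ
a ÷' b = a * inv b

sumL : List ℚ → ℚ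
sumL = foldr _+_ 0ℚ

prodL : List ℚ → ℚ
prodL = foldr _*_ 1ℚ

sumTo : ℕ → (ℕ → ℚ) → ℚ
sumTo zero f = f 0
sumTo (suc n) f = sumTo n f + f (suc n)

fall : ℚ → ℕ → ℚ
fall x zero = 1ℚ
fall x (suc k) = fall x k * (x - ι k)

insertions : {A : Set} → A → List A → List (List A)
insertions a [] = (a ∷ []) ∷ []
insertions a (b ∷ bs) = (a ∷ b ∷ bs) ∷ map (b ∷_) (insertions a bs)

perms : {A : Set} → List A → List (List A)
perms [] = [] ∷ []
perms (a ∷ as) = concatMap (insertions a) (perms as)

-- summand for a permutation ω, written as the list [ω(1), ω(2), …, ω(m)]
permTerm : {m : ℕ} → (Fin m → ℚ) → ℕ → List (Fin m) → ℚ
permTerm x r [] = 0ℚ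
permTerm x r (i ∷ js) =
  fall (x i) r * prodL (map (λ j → (x i + x j) ÷' (x i - x j)) js)

-- P*_(r)(x_1,…,x_m) via the defining formula (m ≥ 1)
Pstar : (m : ℕ) → (Fin m → ℚ) → ℕ → ℚ
Pstar m x r = inv (ι ((m ∸ 1) !)) * sumL (map (permTerm x r) (perms (allFin m)))

Qstar : (m : ℕ) → (Fin m → ℚ) → ℕ → ℚ
Qstar m x zero = 1ℚ
Qstar m x (suc r) = ι 2 * Pstar m x (suc r)

-- formal power series in t = u⁻¹ : coefficient of t^k
Series : Set
Series = ℕ → ℚ

_⊛_ : Series → Series → Series
(f ⊛ g) n = sumTo n (λ k → f k * g (n ∸ k))

oneS : Series
oneS zero = 1ℚ
oneS (suc _) = 0ℚ

prodS : List Series → Series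
prodS = foldr _⊛_ oneS

monoS : ℕ → Series
monoS zero = oneS
monoS (suc r) zero = 0ℚ
monoS (suc r) (suc k) = monoS r k

-- 1 / (1 - a t) = Σ a^k t^k
geomS : ℚ → Series
geomS a zero = 1ℚ
geomS a (suc k) = a * geomS a k

linS : ℚ → Series
linS b zero = 1ℚ
linS b (suc zero) = b
linS b (suc (suc _)) = 0ℚ

-- 1/(u↓r) = t^r ∏_{m=0}^{r-1} 1/(1 - m t)
invFallS : ℕ → Series
invFallS r = monoS r ⊛ prodS (map (λ m → geomS (ι m)) (upTo r))

-- (u+1+x)/(u+1-x) = (1 + (1+x) t) / (1 - (x-1) t)
factorS : ℚ → Series
factorS y = linS (1ℚ + y) ⊛ geomS (y - 1ℚ)

-- coefficient of u^{-N} in Σ_{r≥0} Q*_(r)(x) / (u↓r); terms with r > N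
-- contribute nothing since 1/(u↓r) ∈ u^{-r} ℚ[[u^{-1}]]
lhsS : (n : ℕ) → (Fin n → ℚ) → Series
lhsS n x N = sumTo N (λ r → Qstar n x r * invFallS r N)

rhsS : (n : ℕ) → (Fin n → ℚ) → Series
rhsS n x = prodS (map (λ i → factorS (x i)) (allFin n))

{-# OPTIONS --safe #-}
module Submission where

-- Since (u - r)/(u↓(r+1)) = 1/(u↓r), the coefficients of the Newton series
-- ∑_r (y↓r)/(u↓r) satisfy a first-order recurrence, which identifies the series with
-- (u+1)/(u+1-y) = 1 + y/(u+1-y). Grouping the permutations ω by ω(1) = i gives
-- P*_(r)(x) = ∑_i (x_i↓r) ∏_{j≠i} (x_i+x_j)/(x_i-x_j), so the left-hand side equals
-- 1 + 2 ∑_i x_i/(u+1-x_i) ∏_{j≠i} (x_i+x_j)/(x_i-x_j). This is the partial fraction expansion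
-- of ∏_i (v+x_i)/(v-x_i) at v = u+1. The expansion is proved by induction on the number of
-- variables, both for rational v and coefficientwise in ℚ[[t]]; the inductive step of the
-- latter uses the former at v = x_1.

open import Defs
open import Data.Nat using (ℕ; _≤_)
open import Data.Fin using (Fin)
open import Data.Rational using (ℚ)
open import Relation.Binary.PropositionalEquality using (_≡_; _≢_)

open import Data.Empty using (⊥-elim)
import Data.Fin as Fin
open import Data.Integer as ℤ using () renaming (+_ to ℤ+)
import Data.Integer.Properties as ℤ
open import Data.List using (List; []; _∷_; _++_; map; upTo; length; concatMap; tabulate; allFin)
import Data.List.Properties as List
open import Data.List.Relation.Unary.All using (All; []; _∷_)
import Data.List.Relation.Unary.All as All
import Data.List.Relation.Unary.All.Properties as Allₚ
open import Data.List.Relation.Unary.AllPairs as AllPairs using (AllPairs; _∷_)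
open import Data.List.Relation.Unary.Unique.Propositional.Properties using (allFin⁺)
open import Data.Nat as ℕ using (zero; suc; _!; _∸_; s≤s)
import Data.Nat.Properties as ℕ
import Data.Nat.Coprimality as Coprime
open import Data.Product using (_,_)
open import Data.Rational using (0ℚ; 1ℚ; _+_; _*_; _-_; -_; _/_; mkℚ; ≢-nonZero)
import Data.Rational.Properties as ℚ
open import Function using (_∘_)
open import Level using (0ℓ)
open import Relation.Binary.PropositionalEquality using (refl; sym; trans; cong; cong₂; _≗_; module ≡-Reasoning)
open import Relation.Nullary using (yes; no)
open import Relation.Nullary.Decidable using (dec⇒maybe)
open import Tactic.RingSolver using (solve-∀)
open import Tactic.RingSolver.Core.AlmostCommutativeRing using (AlmostCommutativeRing; fromCommutativeRing)

open ≡-Reasoning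

ℚ-ring : AlmostCommutativeRing 0ℓ 0ℓ
ℚ-ring = fromCommutativeRing ℚ.+-*-commutativeRing (λ q → dec⇒maybe (0ℚ ℚ.≟ q))

ι-mkℚ : ∀ n → ι n ≡ mkℚ (ℤ+ n) 0 (Coprime.sym (Coprime.1-coprimeTo n))
ι-mkℚ n = ℚ.normalize-coprime (Coprime.sym (Coprime.1-coprimeTo n))

ι-suc : ∀ n → ι (suc n) ≡ 1ℚ + ι n
ι-suc n = begin
  (ℤ+ 1 ℤ.+ ℤ+ n) / 1                          ≡⟨ cong (λ z → (ℤ+ 1 ℤ.+ z) / 1) (sym (ℤ.*-identityʳ (ℤ+ n))) ⟩
  1ℚ + mkℚ (ℤ+ n) 0 (Coprime.sym (Coprime.1-coprimeTo n)) ≡⟨ cong (1ℚ +_) (sym (ι-mkℚ n)) ⟩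
  1ℚ + ι n                                  ∎

ι-+ : ∀ m n → ι (m ℕ.+ n) ≡ ι m + ι n
ι-+ zero    n = sym (ℚ.+-identityˡ (ι n))
ι-+ (suc m) n = begin
  ι (suc (m ℕ.+ n))  ≡⟨ ι-suc (m ℕ.+ n) ⟩
  1ℚ + ι (m ℕ.+ n)   ≡⟨ cong (1ℚ +_) (ι-+ m n) ⟩
  1ℚ + (ι m + ι n)   ≡⟨ sym (ℚ.+-assoc 1ℚ (ι m) (ι n)) ⟩
  (1ℚ + ι m) + ι n   ≡⟨ cong (_+ ι n) (sym (ι-suc m)) ⟩
  ι (suc m) + ι n    ∎

ι-* : ∀ m n → ι (m ℕ.* n) ≡ ι m * ι n
ι-* zero    n = sym (ℚ.*-zeroˡ (ι n))
ι-* (suc m) n = begin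
  ι (n ℕ.+ m ℕ.* n)     ≡⟨ ι-+ n (m ℕ.* n) ⟩
  ι n + ι (m ℕ.* n)     ≡⟨ cong (ι n +_) (ι-* m n) ⟩
  ι n + ι m * ι n       ≡⟨ lemma (ι n) (ι m) ⟩
  (1ℚ + ι m) * ι n      ≡⟨ cong (_* ι n) (sym (ι-suc m)) ⟩
  ι (suc m) * ι n       ∎
  where
  lemma : ∀ a b → a + b * a ≡ (1ℚ + b) * a
  lemma = solve-∀ ℚ-ring

ι-suc≢0 : ∀ n → ι (suc n) ≢ 0ℚ
ι-suc≢0 n eq with trans (sym (ι-mkℚ (suc n))) eq
... | ()

ι-!≢0 : ∀ n → ι (n !) ≢ 0ℚ
ι-!≢0 n with n ! | ℕ.1≤n! n
... | suc k | _ = ι-suc≢0 k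

inv-inverseʳ : ∀ {q} → q ≢ 0ℚ → q * inv q ≡ 1ℚ
inv-inverseʳ {q} q≢0 with q ℚ.≟ 0ℚ
... | yes q≡0 = ⊥-elim (q≢0 q≡0)
... | no  q≢0′ = ℚ.*-inverseʳ q {{≢-nonZero q≢0′}}

inv-cancelˡ : ∀ {d} x → d ≢ 0ℚ → inv d * (d * x) ≡ x
inv-cancelˡ {d} x d≢0 = begin
  inv d * (d * x)  ≡⟨ lemma d (inv d) x ⟩
  (d * inv d) * x  ≡⟨ cong (_* x) (inv-inverseʳ d≢0) ⟩
  1ℚ * x           ≡⟨ ℚ.*-identityˡ x ⟩
  x                ∎
  where
  lemma : ∀ a b c → b * (a * c) ≡ (a * b) * c
  lemma = solve-∀ ℚ-ring

inv-unique : ∀ {q r} → q ≢ 0ℚ → q * r ≡ 1ℚ → inv q ≡ r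
inv-unique {q} {r} q≢0 qr≡1 = begin
  inv q            ≡⟨ sym (ℚ.*-identityʳ (inv q)) ⟩
  inv q * 1ℚ       ≡⟨ cong (inv q *_) (sym qr≡1) ⟩
  inv q * (q * r)  ≡⟨ inv-cancelˡ r q≢0 ⟩
  r                ∎

a≢b⇒a-b≢0 : ∀ {a b} → a ≢ b → a - b ≢ 0ℚ
a≢b⇒a-b≢0 {a} {b} a≢b a-b≡0 = a≢b (begin
  a             ≡⟨ lemma a b ⟩
  (a - b) + b   ≡⟨ cong (_+ b) a-b≡0 ⟩
  0ℚ + b        ≡⟨ ℚ.+-identityˡ b ⟩
  b             ∎)
  where
  lemma : ∀ a b → a ≡ (a - b) + b
  lemma = solve-∀ ℚ-ring

inv-swap : ∀ {a b} → a ≢ b → inv (b - a) ≡ - inv (a - b)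
inv-swap {a} {b} a≢b = inv-unique (a≢b⇒a-b≢0 (a≢b ∘ sym)) (begin
  (b - a) * - inv (a - b)  ≡⟨ lemma a b (inv (a - b)) ⟩
  (a - b) * inv (a - b)    ≡⟨ inv-inverseʳ (a≢b⇒a-b≢0 a≢b) ⟩
  1ℚ                       ∎)
  where
  lemma : ∀ a b r → (b - a) * - r ≡ (a - b) * r
  lemma = solve-∀ ℚ-ring

inv-resolvent : ∀ {v a b} → v ≢ a → v ≢ b → a ≢ b →
  inv (v - a) * inv (v - b) ≡ inv (v - a) * inv (a - b) + inv (v - b) * inv (b - a)
inv-resolvent {v} {a} {b} v≢a v≢b a≢b = begin
  p * q                                     ≡⟨ sym (ℚ.*-identityˡ (p * q)) ⟩
  1ℚ * (p * q)                              ≡⟨ cong (λ s → s * (p * q)) (sym (inv-inverseʳ (a≢b⇒a-b≢0 a≢b))) ⟩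
  ((a - b) * r) * (p * q)                   ≡⟨ lemma₁ v a b p q r ⟩
  r * (p * ((v - b) * q) - q * ((v - a) * p))
    ≡⟨ cong₂ (λ s t → r * (p * s - q * t)) (inv-inverseʳ (a≢b⇒a-b≢0 v≢b)) (inv-inverseʳ (a≢b⇒a-b≢0 v≢a)) ⟩
  r * (p * 1ℚ - q * 1ℚ)                     ≡⟨ lemma₂ p q r ⟩
  p * r + q * - r                           ≡⟨ cong (λ s → p * r + q * s) (sym (inv-swap a≢b)) ⟩
  p * r + q * inv (b - a)                   ∎
  where
  p = inv (v - a)
  q = inv (v - b)
  r = inv (a - b)
  lemma₁ : ∀ v a b p q r → ((a - b) * r) * (p * q) ≡ r * (p * ((v - b) * q) - q * ((v - a) * p))
  lemma₁ = solve-∀ ℚ-ring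
  lemma₂ : ∀ p q r → r * (p * 1ℚ - q * 1ℚ) ≡ p * r + q * - r
  lemma₂ = solve-∀ ℚ-ring

cayley : ℚ → ℚ → ℚ
cayley v a = (v + a) ÷' (v - a)

pole : ℚ → ℚ → ℚ
pole v a = (ι 2 * a) ÷' (v - a)

cayley≡1+pole : ∀ {v a} → v ≢ a → cayley v a ≡ 1ℚ + pole v a
cayley≡1+pole {v} {a} v≢a = begin
  (v + a) * inv (v - a)                        ≡⟨ lemma v a (inv (v - a)) ⟩
  (v - a) * inv (v - a) + ι 2 * a * inv (v - a) ≡⟨ cong (_+ pole v a) (inv-inverseʳ (a≢b⇒a-b≢0 v≢a)) ⟩
  1ℚ + pole v a                                ∎
  where
  lemma : ∀ v a r → (v + a) * r ≡ (v - a) * r + ι 2 * a * r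
  lemma = solve-∀ ℚ-ring

pole-resolvent : ∀ {v a b} → v ≢ a → v ≢ b → a ≢ b →
  pole v a * pole v b ≡ pole v a * pole a b + pole v b * pole b a
pole-resolvent {v} {a} {b} v≢a v≢b a≢b = begin
  pole v a * pole v b                                  ≡⟨ lemma₁ a b p q ⟩
  (ι 2 * a) * (ι 2 * b) * (p * q)                      ≡⟨ cong ((ι 2 * a) * (ι 2 * b) *_) (inv-resolvent v≢a v≢b a≢b) ⟩
  (ι 2 * a) * (ι 2 * b) * (p * r + q * r′)             ≡⟨ lemma₂ a b p q r r′ ⟩
  pole v a * pole a b + pole v b * pole b a            ∎
  where
  p = inv (v - a)
  q = inv (v - b)
  r = inv (a - b)
  r′ = inv (b - a)
  lemma₁ : ∀ a b p q → (ι 2 * a * p) * (ι 2 * b * q) ≡ (ι 2 * a) * (ι 2 * b) * (p * q)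
  lemma₁ = solve-∀ ℚ-ring
  lemma₂ : ∀ a b p q r r′ →
    (ι 2 * a) * (ι 2 * b) * (p * r + q * r′) ≡ (ι 2 * a * p) * (ι 2 * b * r) + (ι 2 * b * q) * (ι 2 * a * r′)
  lemma₂ = solve-∀ ℚ-ring

cayley-*-pole : ∀ {v a b} → v ≢ a → v ≢ b → a ≢ b →
  cayley v a * pole v b ≡ pole v a * pole a b + pole v b * cayley b a
cayley-*-pole {v} {a} {b} v≢a v≢b a≢b = begin
  cayley v a * pole v b                          ≡⟨ cong (_* pole v b) (cayley≡1+pole v≢a) ⟩
  (1ℚ + pole v a) * pole v b                     ≡⟨ lemma (pole v a) (pole v b) ⟩
  pole v b + pole v a * pole v b                 ≡⟨ cong (pole v b +_) (pole-resolvent v≢a v≢b a≢b) ⟩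
  pole v b + (pole v a * pole a b + pole v b * pole b a)
    ≡⟨ lemma′ (pole v a) (pole a b) (pole v b) (pole b a) ⟩
  pole v a * pole a b + pole v b * (1ℚ + pole b a)
    ≡⟨ cong (λ s → pole v a * pole a b + pole v b * s) (sym (cayley≡1+pole (a≢b ∘ sym))) ⟩
  pole v a * pole a b + pole v b * cayley b a    ∎
  where
  lemma : ∀ A B → (1ℚ + A) * B ≡ B + A * B
  lemma = solve-∀ ℚ-ring
  lemma′ : ∀ A C B D → B + (A * C + B * D) ≡ A * C + B * (1ℚ + D)
  lemma′ = solve-∀ ℚ-ring

-- Power series in t

sumTo-cong : ∀ N {f g : ℕ → ℚ} → f ≗ g → sumTo N f ≡ sumTo N g
sumTo-cong zero    f≗g = f≗g 0
sumTo-cong (suc N) f≗g = cong₂ _+_ (sumTo-cong N f≗g) (f≗g (suc N))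

sumTo-peel : ∀ N f → sumTo (suc N) f ≡ f 0 + sumTo N (f ∘ suc)
sumTo-peel zero    f = refl
sumTo-peel (suc N) f = trans (cong (_+ f (suc (suc N))) (sumTo-peel N f))
                             (ℚ.+-assoc (f 0) (sumTo N (f ∘ suc)) (f (suc (suc N))))

sumTo-+ : ∀ N f g → sumTo N (λ k → f k + g k) ≡ sumTo N f + sumTo N g
sumTo-+ zero    f g = refl
sumTo-+ (suc N) f g = trans (cong (_+ (f (suc N) + g (suc N))) (sumTo-+ N f g))
                            (lemma (sumTo N f) (sumTo N g) (f (suc N)) (g (suc N)))
  where
  lemma : ∀ a b c d → (a + b) + (c + d) ≡ (a + c) + (b + d)
  lemma = solve-∀ ℚ-ring

sumTo-*ˡ : ∀ N c f → sumTo N (λ k → c * f k) ≡ c * sumTo N f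
sumTo-*ˡ zero    c f = refl
sumTo-*ˡ (suc N) c f = trans (cong (_+ c * f (suc N)) (sumTo-*ˡ N c f))
                             (sym (ℚ.*-distribˡ-+ c (sumTo N f) (f (suc N))))

sumTo-zero : ∀ N → sumTo N (λ _ → 0ℚ) ≡ 0ℚ
sumTo-zero zero    = refl
sumTo-zero (suc N) = cong (_+ 0ℚ) (sumTo-zero N)

⊛-suc : ∀ f g n → (f ⊛ g) (suc n) ≡ f 0 * g (suc n) + ((f ∘ suc) ⊛ g) n
⊛-suc f g n = sumTo-peel n (λ k → f k * g (suc n ∸ k))

⊛-congˡ : ∀ {f f′} g → f ≗ f′ → f ⊛ g ≗ f′ ⊛ g
⊛-congˡ g f≗f′ n = sumTo-cong n (λ k → cong (_* g (n ∸ k)) (f≗f′ k))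

⊛-congʳ : ∀ f {g g′} → g ≗ g′ → f ⊛ g ≗ f ⊛ g′
⊛-congʳ f g≗g′ n = sumTo-cong n (λ k → cong (f k *_) (g≗g′ (n ∸ k)))

⊛-distribʳ-+ : ∀ f f′ g n → ((λ k → f k + f′ k) ⊛ g) n ≡ (f ⊛ g) n + (f′ ⊛ g) n
⊛-distribʳ-+ f f′ g n =
  trans (sumTo-cong n (λ k → ℚ.*-distribʳ-+ (g (n ∸ k)) (f k) (f′ k)))
        (sumTo-+ n (λ k → f k * g (n ∸ k)) (λ k → f′ k * g (n ∸ k)))

⊛-distribˡ-+ : ∀ f g g′ n → (f ⊛ (λ k → g k + g′ k)) n ≡ (f ⊛ g) n + (f ⊛ g′) n
⊛-distribˡ-+ f g g′ n =
  trans (sumTo-cong n (λ k → ℚ.*-distribˡ-+ (f k) (g (n ∸ k)) (g′ (n ∸ k))))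
        (sumTo-+ n (λ k → f k * g (n ∸ k)) (λ k → f k * g′ (n ∸ k)))

⊛-*ˡ : ∀ c f g n → ((λ k → c * f k) ⊛ g) n ≡ c * (f ⊛ g) n
⊛-*ˡ c f g n = trans (sumTo-cong n (λ k → ℚ.*-assoc c (f k) (g (n ∸ k))))
                     (sumTo-*ˡ n c (λ k → f k * g (n ∸ k)))

⊛-*ʳ : ∀ c f g n → (f ⊛ (λ k → c * g k)) n ≡ c * (f ⊛ g) n
⊛-*ʳ c f g n = trans (sumTo-cong n (λ k → lemma c (f k) (g (n ∸ k))))
                     (sumTo-*ˡ n c (λ k → f k * g (n ∸ k)))
  where
  lemma : ∀ a b c → b * (a * c) ≡ a * (b * c)
  lemma = solve-∀ ℚ-ring

⊛-zeroˡ : ∀ g n → ((λ _ → 0ℚ) ⊛ g) n ≡ 0ℚ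
⊛-zeroˡ g n = trans (sumTo-cong n (λ k → ℚ.*-zeroˡ (g (n ∸ k)))) (sumTo-zero n)

-- Peeling f 0 off the left side and g 0 off the right side reduces both to (f ∘ suc) ⊛ (g ∘ suc).
⊛-comm : ∀ f g → f ⊛ g ≗ g ⊛ f
⊛-comm f g zero          = ℚ.*-comm (f 0) (g 0)
⊛-comm f g (suc zero)    = lemma (f 0) (g 1) (f 1) (g 0)
  where
  lemma : ∀ a b c d → a * b + c * d ≡ d * c + b * a
  lemma = solve-∀ ℚ-ring
⊛-comm f g (suc (suc n)) = begin
  (f ⊛ g) (2 ℕ.+ n)                                    ≡⟨ ⊛-suc f g (suc n) ⟩
  f 0 * g (2 ℕ.+ n) + (f′ ⊛ g) (suc n)                 ≡⟨ cong (f 0 * g (2 ℕ.+ n) +_) (⊛-comm f′ g (suc n)) ⟩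
  f 0 * g (2 ℕ.+ n) + (g ⊛ f′) (suc n)                 ≡⟨ cong (f 0 * g (2 ℕ.+ n) +_) (⊛-suc g f′ n) ⟩
  f 0 * g (2 ℕ.+ n) + (g 0 * f (2 ℕ.+ n) + (g′ ⊛ f′) n)
    ≡⟨ cong (λ s → f 0 * g (2 ℕ.+ n) + (g 0 * f (2 ℕ.+ n) + s)) (⊛-comm g′ f′ n) ⟩
  f 0 * g (2 ℕ.+ n) + (g 0 * f (2 ℕ.+ n) + (f′ ⊛ g′) n) ≡⟨ lemma (f 0 * g (2 ℕ.+ n)) (g 0 * f (2 ℕ.+ n)) _ ⟩
  g 0 * f (2 ℕ.+ n) + (f 0 * g (2 ℕ.+ n) + (f′ ⊛ g′) n) ≡⟨ cong (g 0 * f (2 ℕ.+ n) +_) (sym (⊛-suc f g′ n)) ⟩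
  g 0 * f (2 ℕ.+ n) + (f ⊛ g′) (suc n)                 ≡⟨ cong (g 0 * f (2 ℕ.+ n) +_) (⊛-comm f g′ (suc n)) ⟩
  g 0 * f (2 ℕ.+ n) + (g′ ⊛ f) (suc n)                 ≡⟨ sym (⊛-suc g f (suc n)) ⟩
  (g ⊛ f) (2 ℕ.+ n)                                    ∎
  where
  f′ = f ∘ suc
  g′ = g ∘ suc
  lemma : ∀ a b c → a + (b + c) ≡ b + (a + c)
  lemma = solve-∀ ℚ-ring

⊛-assoc : ∀ f g h → (f ⊛ g) ⊛ h ≗ f ⊛ (g ⊛ h)
⊛-assoc f g h zero    = ℚ.*-assoc (f 0) (g 0) (h 0)
⊛-assoc f g h (suc n) = begin
  ((f ⊛ g) ⊛ h) (suc n)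
    ≡⟨ ⊛-suc (f ⊛ g) h n ⟩
  f 0 * g 0 * h (suc n) + (((f ⊛ g) ∘ suc) ⊛ h) n
    ≡⟨ cong (f 0 * g 0 * h (suc n) +_) (⊛-congˡ h (⊛-suc f g) n) ⟩
  f 0 * g 0 * h (suc n) + ((λ k → f 0 * g (suc k) + ((f ∘ suc) ⊛ g) k) ⊛ h) n
    ≡⟨ cong (f 0 * g 0 * h (suc n) +_) (⊛-distribʳ-+ (λ k → f 0 * g (suc k)) ((f ∘ suc) ⊛ g) h n) ⟩
  f 0 * g 0 * h (suc n) + (((λ k → f 0 * g (suc k)) ⊛ h) n + (((f ∘ suc) ⊛ g) ⊛ h) n)
    ≡⟨ cong₂ (λ s t → f 0 * g 0 * h (suc n) + (s + t)) (⊛-*ˡ (f 0) (g ∘ suc) h n) (⊛-assoc (f ∘ suc) g h n) ⟩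
  f 0 * g 0 * h (suc n) + (f 0 * ((g ∘ suc) ⊛ h) n + ((f ∘ suc) ⊛ (g ⊛ h)) n)
    ≡⟨ lemma (f 0) (g 0) (h (suc n)) _ _ ⟩
  f 0 * (g 0 * h (suc n) + ((g ∘ suc) ⊛ h) n) + ((f ∘ suc) ⊛ (g ⊛ h)) n
    ≡⟨ cong (λ s → f 0 * s + ((f ∘ suc) ⊛ (g ⊛ h)) n) (sym (⊛-suc g h n)) ⟩
  f 0 * (g ⊛ h) (suc n) + ((f ∘ suc) ⊛ (g ⊛ h)) n
    ≡⟨ sym (⊛-suc f (g ⊛ h) n) ⟩
  (f ⊛ (g ⊛ h)) (suc n) ∎
  where
  lemma : ∀ a b c d e → a * b * c + (a * d + e) ≡ a * (b * c + d) + e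
  lemma = solve-∀ ℚ-ring

⊛-identityˡ : ∀ g → oneS ⊛ g ≗ g
⊛-identityˡ g zero    = ℚ.*-identityˡ (g 0)
⊛-identityˡ g (suc n) = begin
  (oneS ⊛ g) (suc n)                   ≡⟨ ⊛-suc oneS g n ⟩
  1ℚ * g (suc n) + ((λ _ → 0ℚ) ⊛ g) n  ≡⟨ cong₂ _+_ (ℚ.*-identityˡ (g (suc n))) (⊛-zeroˡ g n) ⟩
  g (suc n) + 0ℚ                       ≡⟨ ℚ.+-identityʳ (g (suc n)) ⟩
  g (suc n)                            ∎

⊛-identityʳ : ∀ f → f ⊛ oneS ≗ f
⊛-identityʳ f n = trans (⊛-comm f oneS n) (⊛-identityˡ f n)

prodS-∷ʳ : ∀ fs f → prodS (fs ++ f ∷ []) ≗ f ⊛ prodS fs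
prodS-∷ʳ []       f n = refl
prodS-∷ʳ (h ∷ fs) f n = begin
  (h ⊛ prodS (fs ++ f ∷ [])) n  ≡⟨ ⊛-congʳ h (prodS-∷ʳ fs f) n ⟩
  (h ⊛ (f ⊛ prodS fs)) n        ≡⟨ sym (⊛-assoc h f (prodS fs) n) ⟩
  ((h ⊛ f) ⊛ prodS fs) n        ≡⟨ ⊛-congˡ (prodS fs) (⊛-comm h f) n ⟩
  ((f ⊛ h) ⊛ prodS fs) n        ≡⟨ ⊛-assoc f h (prodS fs) n ⟩
  (f ⊛ (h ⊛ prodS fs)) n        ∎

-- 1/(u↓r) and the Newton series

geomS-⊛-suc : ∀ c h n → (geomS c ⊛ h) (suc n) ≡ c * (geomS c ⊛ h) n + h (suc n)
geomS-⊛-suc c h n = begin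
  (geomS c ⊛ h) (suc n)                              ≡⟨ ⊛-suc (geomS c) h n ⟩
  1ℚ * h (suc n) + ((λ k → c * geomS c k) ⊛ h) n     ≡⟨ cong (1ℚ * h (suc n) +_) (⊛-*ˡ c (geomS c) h n) ⟩
  1ℚ * h (suc n) + c * (geomS c ⊛ h) n               ≡⟨ lemma (h (suc n)) _ ⟩
  c * (geomS c ⊛ h) n + h (suc n)                    ∎
  where
  lemma : ∀ a b → 1ℚ * a + b ≡ b + a
  lemma = solve-∀ ℚ-ring

monoS-⊛-suc : ∀ r g n → (monoS (suc r) ⊛ g) (suc n) ≡ (monoS r ⊛ g) n
monoS-⊛-suc r g n = trans (⊛-suc (monoS (suc r)) g n) (lemma (g (suc n)) _)
  where
  lemma : ∀ a b → 0ℚ * a + b ≡ b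
  lemma = solve-∀ ℚ-ring

monoS-⊛-vanish : ∀ {r n} g → n ℕ.< r → (monoS r ⊛ g) n ≡ 0ℚ
monoS-⊛-vanish {suc r} {zero}  g _         = ℚ.*-zeroˡ (g 0)
monoS-⊛-vanish {suc r} {suc n} g (s≤s n<r) = trans (monoS-⊛-suc r g n) (monoS-⊛-vanish g n<r)

geomProd : ℕ → Series
geomProd r = prodS (map (λ m → geomS (ι m)) (upTo r))

geomProd-suc : ∀ r → geomProd (suc r) ≗ geomS (ι r) ⊛ geomProd r
geomProd-suc r n = begin
  prodS (map G (upTo (suc r))) n            ≡⟨ cong (λ l → prodS (map G l) n) (sym (List.upTo-∷ʳ r)) ⟩
  prodS (map G (upTo r ++ r ∷ [])) n        ≡⟨ cong (λ l → prodS l n) (List.map-++ G (upTo r) (r ∷ [])) ⟩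
  prodS (map G (upTo r) ++ G r ∷ []) n      ≡⟨ prodS-∷ʳ (map G (upTo r)) (G r) n ⟩
  (G r ⊛ geomProd r) n                      ∎
  where
  G = λ m → geomS (ι m)

invFallS-vanish : ∀ {r n} → n ℕ.< r → invFallS r n ≡ 0ℚ
invFallS-vanish {r} = monoS-⊛-vanish (geomProd r)

invFallS-zero : invFallS 0 ≗ oneS
invFallS-zero = ⊛-identityˡ oneS

-- (u - r) / (u ↓ (r + 1)) = 1 / (u ↓ r)
invFallS-rec : ∀ r n → invFallS (suc r) (suc n) ≡ ι r * invFallS (suc r) n + invFallS r n
invFallS-rec r n = trans (shift n) (step n)
  where
  W = geomS (ι r) ⊛ invFallS r
  shift : ∀ n → invFallS (suc r) (suc n) ≡ W n
  shift n = begin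
    (monoS (suc r) ⊛ geomProd (suc r)) (suc n)        ≡⟨ monoS-⊛-suc r (geomProd (suc r)) n ⟩
    (monoS r ⊛ geomProd (suc r)) n                    ≡⟨ ⊛-congʳ (monoS r) (geomProd-suc r) n ⟩
    (monoS r ⊛ (geomS (ι r) ⊛ geomProd r)) n          ≡⟨ sym (⊛-assoc (monoS r) (geomS (ι r)) (geomProd r) n) ⟩
    ((monoS r ⊛ geomS (ι r)) ⊛ geomProd r) n          ≡⟨ ⊛-congˡ (geomProd r) (⊛-comm (monoS r) (geomS (ι r))) n ⟩
    ((geomS (ι r) ⊛ monoS r) ⊛ geomProd r) n          ≡⟨ ⊛-assoc (geomS (ι r)) (monoS r) (geomProd r) n ⟩
    W n                                               ∎
  step : ∀ n → W n ≡ ι r * invFallS (suc r) n + invFallS r n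
  step zero    = begin
    1ℚ * invFallS r 0                   ≡⟨ lemma (ι r) (invFallS r 0) ⟩
    ι r * 0ℚ + invFallS r 0             ≡⟨ cong (λ s → ι r * s + invFallS r 0) (sym (invFallS-vanish {suc r} {0} ℕ.z<s)) ⟩
    ι r * invFallS (suc r) 0 + invFallS r 0 ∎
    where
    lemma : ∀ a b → 1ℚ * b ≡ a * 0ℚ + b
    lemma = solve-∀ ℚ-ring
  step (suc n) = begin
    W (suc n)                                   ≡⟨ geomS-⊛-suc (ι r) (invFallS r) n ⟩
    ι r * W n + invFallS r (suc n)              ≡⟨ cong (λ s → ι r * s + invFallS r (suc n)) (sym (shift n)) ⟩
    ι r * invFallS (suc r) (suc n) + invFallS r (suc n) ∎

-- newtonTerm y n r = [tⁿ] (y ↓ r) / (u ↓ r), which vanishes for r > n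
newtonTerm : ℚ → ℕ → ℕ → ℚ
newtonTerm y n r = fall y r * invFallS r n

newtonS : ℚ → Series
newtonS y n = sumTo n (newtonTerm y n)

-- y / (u + 1 - y) = y t / (1 - (y - 1) t)
poleS : ℚ → Series
poleS y zero    = 0ℚ
poleS y (suc k) = y * geomS (y - 1ℚ) k

newtonTerm-suc : ∀ y n r → newtonTerm y (suc n) (suc r)
  ≡ (ι (suc r) - 1ℚ) * newtonTerm y n (suc r) + (y - ι r) * newtonTerm y n r
newtonTerm-suc y n r = begin
  fall y r * (y - ι r) * invFallS (suc r) (suc n)
    ≡⟨ cong (fall y r * (y - ι r) *_) (invFallS-rec r n) ⟩
  fall y r * (y - ι r) * (ι r * invFallS (suc r) n + invFallS r n)
    ≡⟨ lemma (fall y r) y (ι r) (invFallS (suc r) n) (invFallS r n) ⟩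
  ((1ℚ + ι r) - 1ℚ) * newtonTerm y n (suc r) + (y - ι r) * newtonTerm y n r
    ≡⟨ cong (λ s → (s - 1ℚ) * newtonTerm y n (suc r) + (y - ι r) * newtonTerm y n r) (sym (ι-suc r)) ⟩
  (ι (suc r) - 1ℚ) * newtonTerm y n (suc r) + (y - ι r) * newtonTerm y n r ∎
  where
  lemma : ∀ F y a I′ I → F * (y - a) * (a * I′ + I) ≡ ((1ℚ + a) - 1ℚ) * (F * (y - a) * I′) + (y - a) * (F * I)
  lemma = solve-∀ ℚ-ring

-- Reindexing ∑_r ι r T (r + 1) as ∑_s (ι s - 1) T s leaves the boundary terms
-- -T 0 = -1 at s = 0 and T (n + 1) = 0 at s = n + 1.
newtonS-suc : ∀ y n → newtonS y (suc n) ≡ (y - 1ℚ) * newtonS y n + oneS n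
newtonS-suc y n = begin
  newtonS y (suc n)
    ≡⟨ sumTo-peel n (newtonTerm y (suc n)) ⟩
  1ℚ * invFallS 0 (suc n) + sumTo n (newtonTerm y (suc n) ∘ suc)
    ≡⟨ cong₂ (λ s t → 1ℚ * s + t) (invFallS-zero (suc n)) (sumTo-cong n (newtonTerm-suc y n)) ⟩
  1ℚ * 0ℚ + sumTo n (λ r → φ (suc r) + ψ r)
    ≡⟨ cong (1ℚ * 0ℚ +_) (sumTo-+ n (φ ∘ suc) ψ) ⟩
  1ℚ * 0ℚ + (sumTo n (φ ∘ suc) + sumTo n ψ)
    ≡⟨ lemma₁ (sumTo n (φ ∘ suc)) (sumTo n ψ) (φ 0) ⟩
  (φ 0 + sumTo n (φ ∘ suc)) + sumTo n ψ - φ 0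
    ≡⟨ cong (λ s → s + sumTo n ψ - φ 0) (sym (sumTo-peel n φ)) ⟩
  sumTo n φ + φ (suc n) + sumTo n ψ - φ 0
    ≡⟨ cong (λ s → sumTo n φ + (ι (suc n) - 1ℚ) * (fall y (suc n) * s) + sumTo n ψ - φ 0)
            (invFallS-vanish {suc n} (ℕ.n<1+n n)) ⟩
  sumTo n φ + (ι (suc n) - 1ℚ) * (fall y (suc n) * 0ℚ) + sumTo n ψ - (0ℚ - 1ℚ) * (1ℚ * invFallS 0 n)
    ≡⟨ lemma₂ (sumTo n φ) (ι (suc n)) (fall y (suc n)) (sumTo n ψ) (invFallS 0 n) ⟩
  (sumTo n φ + sumTo n ψ) + invFallS 0 n
    ≡⟨ cong₂ _+_ (sym (sumTo-+ n φ ψ)) (invFallS-zero n) ⟩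
  sumTo n (λ s → φ s + ψ s) + oneS n
    ≡⟨ cong (_+ oneS n) (sumTo-cong n (λ s → lemma₃ (ι s) y (newtonTerm y n s))) ⟩
  sumTo n (λ s → (y - 1ℚ) * newtonTerm y n s) + oneS n
    ≡⟨ cong (_+ oneS n) (sumTo-*ˡ n (y - 1ℚ) (newtonTerm y n)) ⟩
  (y - 1ℚ) * newtonS y n + oneS n ∎
  where
  φ ψ : ℕ → ℚ
  φ s = (ι s - 1ℚ) * newtonTerm y n s
  ψ s = (y - ι s) * newtonTerm y n s
  lemma₁ : ∀ X Y a → 1ℚ * 0ℚ + (X + Y) ≡ (a + X) + Y - a
  lemma₁ = solve-∀ ℚ-ring
  lemma₂ : ∀ Φ a F Ψ I → Φ + (a - 1ℚ) * (F * 0ℚ) + Ψ - (0ℚ - 1ℚ) * (1ℚ * I) ≡ (Φ + Ψ) + I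
  lemma₂ = solve-∀ ℚ-ring
  lemma₃ : ∀ a y T → (a - 1ℚ) * T + (y - a) * T ≡ (y - 1ℚ) * T
  lemma₃ = solve-∀ ℚ-ring

newtonS≡1+poleS : ∀ y n → newtonS y n ≡ oneS n + poleS y n
newtonS≡1+poleS y zero = cong (1ℚ *_) (invFallS-zero 0)
newtonS≡1+poleS y (suc zero) = begin
  newtonS y 1                      ≡⟨ newtonS-suc y 0 ⟩
  (y - 1ℚ) * newtonS y 0 + 1ℚ      ≡⟨ cong (λ s → (y - 1ℚ) * s + 1ℚ) (newtonS≡1+poleS y 0) ⟩
  (y - 1ℚ) * (1ℚ + 0ℚ) + 1ℚ        ≡⟨ lemma y ⟩
  0ℚ + y * 1ℚ                      ∎
  where
  lemma : ∀ y → (y - 1ℚ) * (1ℚ + 0ℚ) + 1ℚ ≡ 0ℚ + y * 1ℚ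
  lemma = solve-∀ ℚ-ring
newtonS≡1+poleS y (suc (suc n)) = begin
  newtonS y (2 ℕ.+ n)                                ≡⟨ newtonS-suc y (suc n) ⟩
  (y - 1ℚ) * newtonS y (suc n) + 0ℚ                  ≡⟨ cong (λ s → (y - 1ℚ) * s + 0ℚ) (newtonS≡1+poleS y (suc n)) ⟩
  (y - 1ℚ) * (0ℚ + y * geomS (y - 1ℚ) n) + 0ℚ        ≡⟨ lemma y (geomS (y - 1ℚ) n) ⟩
  0ℚ + y * ((y - 1ℚ) * geomS (y - 1ℚ) n)             ∎
  where
  lemma : ∀ y G → (y - 1ℚ) * (0ℚ + y * G) + 0ℚ ≡ 0ℚ + y * ((y - 1ℚ) * G)
  lemma = solve-∀ ℚ-ring

newtonS-tail : ∀ y n → sumTo n (newtonTerm y (suc n) ∘ suc) ≡ poleS y (suc n)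
newtonS-tail y n = begin
  T                                  ≡⟨ sym (ℚ.+-identityˡ T) ⟩
  1ℚ * 0ℚ + T                        ≡⟨ cong (λ s → 1ℚ * s + T) (sym (invFallS-zero (suc n))) ⟩
  1ℚ * invFallS 0 (suc n) + T        ≡⟨ sym (sumTo-peel n (newtonTerm y (suc n))) ⟩
  newtonS y (suc n)                  ≡⟨ newtonS≡1+poleS y (suc n) ⟩
  0ℚ + poleS y (suc n)               ≡⟨ ℚ.+-identityˡ (poleS y (suc n)) ⟩
  poleS y (suc n)                    ∎
  where
  T = sumTo n (newtonTerm y (suc n) ∘ suc)

linS-⊛-suc : ∀ b h n → (linS b ⊛ h) (suc n) ≡ h (suc n) + b * h n
linS-⊛-suc b h n = begin
  (linS b ⊛ h) (suc n)                     ≡⟨ ⊛-suc (linS b) h n ⟩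
  1ℚ * h (suc n) + ((linS b ∘ suc) ⊛ h) n  ≡⟨ cong₂ _+_ (ℚ.*-identityˡ (h (suc n))) (tail-⊛ n) ⟩
  h (suc n) + b * h n                      ∎
  where
  tail-⊛ : ∀ n → ((linS b ∘ suc) ⊛ h) n ≡ b * h n
  tail-⊛ zero    = refl
  tail-⊛ (suc n) = begin
    ((linS b ∘ suc) ⊛ h) (suc n)              ≡⟨ ⊛-suc (linS b ∘ suc) h n ⟩
    b * h (suc n) + ((λ _ → 0ℚ) ⊛ h) n        ≡⟨ cong (b * h (suc n) +_) (⊛-zeroˡ h n) ⟩
    b * h (suc n) + 0ℚ                        ≡⟨ ℚ.+-identityʳ (b * h (suc n)) ⟩
    b * h (suc n)                             ∎

factorS≡1+2poleS : ∀ a → factorS a ≗ (λ k → oneS k + ι 2 * poleS a k)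
factorS≡1+2poleS a zero    = refl
factorS≡1+2poleS a (suc k) = begin
  factorS a (suc k)                                          ≡⟨ linS-⊛-suc (1ℚ + a) (geomS (a - 1ℚ)) k ⟩
  (a - 1ℚ) * geomS (a - 1ℚ) k + (1ℚ + a) * geomS (a - 1ℚ) k  ≡⟨ lemma a (geomS (a - 1ℚ) k) ⟩
  0ℚ + ι 2 * (a * geomS (a - 1ℚ) k)                          ∎
  where
  lemma : ∀ a G → (a - 1ℚ) * G + (1ℚ + a) * G ≡ 0ℚ + ι 2 * (a * G)
  lemma = solve-∀ ℚ-ring

poleS-⊛-suc : ∀ a h n → (poleS a ⊛ h) (suc n) ≡ a * (geomS (a - 1ℚ) ⊛ h) n
poleS-⊛-suc a h n = begin
  (poleS a ⊛ h) (suc n)                                 ≡⟨ ⊛-suc (poleS a) h n ⟩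
  0ℚ * h (suc n) + ((λ k → a * geomS (a - 1ℚ) k) ⊛ h) n
    ≡⟨ cong₂ _+_ (ℚ.*-zeroˡ (h (suc n))) (⊛-*ˡ a (geomS (a - 1ℚ)) h n) ⟩
  0ℚ + a * (geomS (a - 1ℚ) ⊛ h) n                       ≡⟨ ℚ.+-identityˡ _ ⟩
  a * (geomS (a - 1ℚ) ⊛ h) n                            ∎

geomS-⊛-poleS : ∀ α b n → (α - (b - 1ℚ)) * (geomS α ⊛ poleS b) n ≡ b * (geomS α n - geomS (b - 1ℚ) n)
geomS-⊛-poleS α b zero    = lemma α b
  where
  lemma : ∀ α b → (α - (b - 1ℚ)) * (1ℚ * 0ℚ) ≡ b * (1ℚ - 1ℚ)
  lemma = solve-∀ ℚ-ring
geomS-⊛-poleS α b (suc n) = begin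
  (α - β) * (geomS α ⊛ poleS b) (suc n)           ≡⟨ cong ((α - β) *_) (geomS-⊛-suc α (poleS b) n) ⟩
  (α - β) * (α * W + b * geomS β n)               ≡⟨ lemma₁ α β b W (geomS β n) ⟩
  α * ((α - β) * W) + (α - β) * (b * geomS β n)
    ≡⟨ cong (λ s → α * s + (α - β) * (b * geomS β n)) (geomS-⊛-poleS α b n) ⟩
  α * (b * (geomS α n - geomS β n)) + (α - β) * (b * geomS β n)
                                                  ≡⟨ lemma₂ α β b (geomS α n) (geomS β n) ⟩
  b * (α * geomS α n - β * geomS β n)             ∎
  where
  β = b - 1ℚ
  W = (geomS α ⊛ poleS b) n
  lemma₁ : ∀ α β b w g → (α - β) * (α * w + b * g) ≡ α * ((α - β) * w) + (α - β) * (b * g)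
  lemma₁ = solve-∀ ℚ-ring
  lemma₂ : ∀ α β b g g′ → α * (b * (g - g′)) + (α - β) * (b * g′) ≡ b * (α * g - β * g′)
  lemma₂ = solve-∀ ℚ-ring

poleS-⊛-poleS : ∀ a b n → (a - b) * (poleS a ⊛ poleS b) n ≡ b * poleS a n - a * poleS b n
poleS-⊛-poleS a b zero    = lemma a b
  where
  lemma : ∀ a b → (a - b) * (0ℚ * 0ℚ) ≡ b * 0ℚ - a * 0ℚ
  lemma = solve-∀ ℚ-ring
poleS-⊛-poleS a b (suc n) = begin
  (a - b) * (poleS a ⊛ poleS b) (suc n)            ≡⟨ cong ((a - b) *_) (poleS-⊛-suc a (poleS b) n) ⟩
  (a - b) * (a * W)                                ≡⟨ lemma₁ a b W ⟩
  a * (((a - 1ℚ) - (b - 1ℚ)) * W)                  ≡⟨ cong (a *_) (geomS-⊛-poleS (a - 1ℚ) b n) ⟩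
  a * (b * (geomS (a - 1ℚ) n - geomS (b - 1ℚ) n))  ≡⟨ lemma₂ a b (geomS (a - 1ℚ) n) (geomS (b - 1ℚ) n) ⟩
  b * (a * geomS (a - 1ℚ) n) - a * (b * geomS (b - 1ℚ) n) ∎
  where
  W = (geomS (a - 1ℚ) ⊛ poleS b) n
  lemma₁ : ∀ a b w → (a - b) * (a * w) ≡ a * (((a - 1ℚ) - (b - 1ℚ)) * w)
  lemma₁ = solve-∀ ℚ-ring
  lemma₂ : ∀ a b g g′ → a * (b * (g - g′)) ≡ b * (a * g) - a * (b * g′)
  lemma₂ = solve-∀ ℚ-ring

factorS-⊛-poleS : ∀ {a b} → a ≢ b → ∀ n →
  (factorS a ⊛ poleS b) n ≡ cayley b a * poleS b n + pole a b * poleS a n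
factorS-⊛-poleS {a} {b} a≢b n = begin
  (factorS a ⊛ poleS b) n
    ≡⟨ ⊛-congˡ (poleS b) (factorS≡1+2poleS a) n ⟩
  ((λ k → oneS k + ι 2 * poleS a k) ⊛ poleS b) n
    ≡⟨ ⊛-distribʳ-+ oneS (λ k → ι 2 * poleS a k) (poleS b) n ⟩
  (oneS ⊛ poleS b) n + ((λ k → ι 2 * poleS a k) ⊛ poleS b) n
    ≡⟨ cong₂ _+_ (⊛-identityˡ (poleS b) n) (⊛-*ˡ (ι 2) (poleS a) (poleS b) n) ⟩
  B + ι 2 * (poleS a ⊛ poleS b) n
    ≡⟨ cong (λ s → B + ι 2 * s) (sym (inv-cancelˡ _ (a≢b⇒a-b≢0 a≢b))) ⟩
  B + ι 2 * (r * ((a - b) * (poleS a ⊛ poleS b) n))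
    ≡⟨ cong (λ s → B + ι 2 * (r * s)) (poleS-⊛-poleS a b n) ⟩
  B + ι 2 * (r * (b * A - a * B))
    ≡⟨ lemma a b r A B ⟩
  (1ℚ + ι 2 * a * - r) * B + pole a b * A
    ≡⟨ cong (λ s → (1ℚ + ι 2 * a * s) * B + pole a b * A) (sym (inv-swap a≢b)) ⟩
  (1ℚ + pole b a) * B + pole a b * A
    ≡⟨ cong (λ s → s * B + pole a b * A) (sym (cayley≡1+pole (a≢b ∘ sym))) ⟩
  cayley b a * B + pole a b * A ∎
  where
  A = poleS a n
  B = poleS b n
  r = inv (a - b)
  lemma : ∀ a b r A B → B + ι 2 * (r * (b * A - a * B)) ≡ (1ℚ + ι 2 * a * - r) * B + ι 2 * b * r * A
  lemma = solve-∀ ℚ-ring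

-- Symmetrisation over permutations

sumL-++ : ∀ xs ys → sumL (xs ++ ys) ≡ sumL xs + sumL ys
sumL-++ []       ys = sym (ℚ.+-identityˡ (sumL ys))
sumL-++ (x ∷ xs) ys = trans (cong (x +_) (sumL-++ xs ys)) (sym (ℚ.+-assoc x (sumL xs) (sumL ys)))

module _ {B : Set} where

  sumL-+ : ∀ (φ ψ : B → ℚ) l → sumL (map (λ q → φ q + ψ q) l) ≡ sumL (map φ l) + sumL (map ψ l)
  sumL-+ φ ψ []      = refl
  sumL-+ φ ψ (q ∷ l) = trans (cong (φ q + ψ q +_) (sumL-+ φ ψ l)) (lemma (φ q) (ψ q) _ _)
    where
    lemma : ∀ a b c d → (a + b) + (c + d) ≡ (a + c) + (b + d)
    lemma = solve-∀ ℚ-ring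

  sumL-*ˡ : ∀ c (φ : B → ℚ) l → sumL (map (λ q → c * φ q) l) ≡ c * sumL (map φ l)
  sumL-*ˡ c φ []      = sym (ℚ.*-zeroʳ c)
  sumL-*ˡ c φ (q ∷ l) = trans (cong (c * φ q +_) (sumL-*ˡ c φ l)) (sym (ℚ.*-distribˡ-+ c (φ q) _))

  sumL-map-concatMap : ∀ {C : Set} (φ : C → ℚ) (h : B → List C) l →
    sumL (map φ (concatMap h l)) ≡ sumL (map (λ q → sumL (map φ (h q))) l)
  sumL-map-concatMap φ h []      = refl
  sumL-map-concatMap φ h (q ∷ l) = begin
    sumL (map φ (h q ++ concatMap h l))                 ≡⟨ cong sumL (List.map-++ φ (h q) (concatMap h l)) ⟩
    sumL (map φ (h q) ++ map φ (concatMap h l))         ≡⟨ sumL-++ (map φ (h q)) (map φ (concatMap h l)) ⟩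
    sumL (map φ (h q)) + sumL (map φ (concatMap h l))   ≡⟨ cong (sumL (map φ (h q)) +_) (sumL-map-concatMap φ h l) ⟩
    sumL (map φ (h q)) + sumL (map (λ q → sumL (map φ (h q))) l) ∎

module _ {A : Set} where

  length-insertions : ∀ (a : A) q → All (λ p → length p ≡ suc (length q)) (insertions a q)
  length-insertions a []       = refl ∷ []
  length-insertions a (b ∷ bs) = refl ∷ Allₚ.map⁺ (All.map (cong suc) (length-insertions a bs))

  length-perms : ∀ (l : List A) → All (λ q → length q ≡ length l) (perms l)
  length-perms []       = refl ∷ []
  length-perms (a ∷ as) = Allₚ.concat⁺ (Allₚ.map⁺ (All.map
    (λ {q} eq → All.map (λ eq′ → trans eq′ (cong suc eq)) (length-insertions a q)) (length-perms as)))

  sumL-insertions-prodL : ∀ (a : A) bs h →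
    sumL (map (λ p → prodL (map h p)) (insertions a bs)) ≡ ι (suc (length bs)) * prodL (map h (a ∷ bs))
  sumL-insertions-prodL a []       h = lemma (h a)
    where
    lemma : ∀ x → x * 1ℚ + 0ℚ ≡ ι 1 * (x * 1ℚ)
    lemma = solve-∀ ℚ-ring
  sumL-insertions-prodL a (b ∷ bs) h = begin
    Π (a ∷ b ∷ bs) + sumL (map Π (map (b ∷_) (insertions a bs)))
      ≡⟨ cong (λ s → Π (a ∷ b ∷ bs) + sumL s) (sym (List.map-∘ (insertions a bs))) ⟩
    Π (a ∷ b ∷ bs) + sumL (map (λ p → h b * Π p) (insertions a bs))
      ≡⟨ cong (Π (a ∷ b ∷ bs) +_) (sumL-*ˡ (h b) Π (insertions a bs)) ⟩
    Π (a ∷ b ∷ bs) + h b * sumL (map Π (insertions a bs))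
      ≡⟨ cong (λ s → Π (a ∷ b ∷ bs) + h b * s) (sumL-insertions-prodL a bs h) ⟩
    Π (a ∷ b ∷ bs) + h b * (ι (suc (length bs)) * (h a * Π bs))
      ≡⟨ lemma (h a) (h b) (Π bs) (ι (suc (length bs))) ⟩
    (1ℚ + ι (suc (length bs))) * Π (a ∷ b ∷ bs)
      ≡⟨ cong (_* Π (a ∷ b ∷ bs)) (sym (ι-suc (suc (length bs)))) ⟩
    ι (suc (suc (length bs))) * Π (a ∷ b ∷ bs) ∎
    where
    Π = λ p → prodL (map h p)
    lemma : ∀ x y p i → x * (y * p) + y * (i * (x * p)) ≡ (1ℚ + i) * (x * (y * p))
    lemma = solve-∀ ℚ-ring

  sumL-perms-prodL : ∀ (as : List A) h → sumL (map (λ q → prodL (map h q)) (perms as)) ≡ ι (length as !) * prodL (map h as)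
  sumL-perms-prodL []       h = refl
  sumL-perms-prodL (a ∷ as) h = begin
    sumL (map Π (concatMap (insertions a) (perms as)))
      ≡⟨ sumL-map-concatMap Π (insertions a) (perms as) ⟩
    sumL (map (λ q → sumL (map Π (insertions a q))) (perms as))
      ≡⟨ cong sumL (List.map-cong (λ q → sumL-insertions-prodL a q h) (perms as)) ⟩
    sumL (map (λ q → ι (suc (length q)) * (h a * Π q)) (perms as))
      ≡⟨ cong sumL (List.map-cong-local (All.map (λ {q} eq → cong (λ k → ι (suc k) * (h a * Π q)) eq) (length-perms as))) ⟩
    sumL (map (λ q → ι (suc (length as)) * (h a * Π q)) (perms as))
      ≡⟨ sumL-*ˡ (ι (suc (length as))) (λ q → h a * Π q) (perms as) ⟩
    ι (suc (length as)) * sumL (map (λ q → h a * Π q) (perms as))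
      ≡⟨ cong (ι (suc (length as)) *_) (sumL-*ˡ (h a) Π (perms as)) ⟩
    ι (suc (length as)) * (h a * sumL (map Π (perms as)))
      ≡⟨ cong (λ s → ι (suc (length as)) * (h a * s)) (sumL-perms-prodL as h) ⟩
    ι (suc (length as)) * (h a * (ι (length as !) * Π as))
      ≡⟨ lemma (ι (suc (length as))) (ι (length as !)) (h a) (Π as) ⟩
    (ι (suc (length as)) * ι (length as !)) * Π (a ∷ as)
      ≡⟨ cong (_* Π (a ∷ as)) (sym (ι-* (suc (length as)) (length as !))) ⟩
    ι (suc (length as) !) * Π (a ∷ as) ∎
    where
    Π = λ p → prodL (map h p)
    lemma : ∀ i j x p → i * (x * (j * p)) ≡ (i * j) * (x * p)
    lemma = solve-∀ ℚ-ring

-- lagrange f L = ∑_{i ∈ L} f i ∏_{j ∈ L, j ≠ i} g i j, with j ≠ i meaning another position of L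
module Lagrange {A : Set} (g : A → A → ℚ) where

  lagrange : (A → ℚ) → List A → ℚ
  lagrange f []       = 0ℚ
  lagrange f (a ∷ as) = f a * prodL (map (g a) as) + lagrange (λ i → f i * g i a) as

  lagrange-cong-local : ∀ {f f′} L → All (λ i → f i ≡ f′ i) L → lagrange f L ≡ lagrange f′ L
  lagrange-cong-local []       []       = refl
  lagrange-cong-local (a ∷ as) (eq ∷ eqs) =
    cong₂ _+_ (cong (_* prodL (map (g a) as)) eq) (lagrange-cong-local as (All.map (λ {i} → cong (_* g i a)) eqs))

  lagrange-cong : ∀ {f f′} → f ≗ f′ → ∀ L → lagrange f L ≡ lagrange f′ L
  lagrange-cong f≗f′ L = lagrange-cong-local L (All.universal f≗f′ L)

  lagrange-+ : ∀ f f′ L → lagrange (λ i → f i + f′ i) L ≡ lagrange f L + lagrange f′ L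
  lagrange-+ f f′ []       = sym (ℚ.+-identityˡ 0ℚ)
  lagrange-+ f f′ (a ∷ as) = begin
    (f a + f′ a) * P + lagrange (λ i → (f i + f′ i) * g i a) as
      ≡⟨ cong ((f a + f′ a) * P +_) (lagrange-cong (λ i → ℚ.*-distribʳ-+ (g i a) (f i) (f′ i)) as) ⟩
    (f a + f′ a) * P + lagrange (λ i → f i * g i a + f′ i * g i a) as
      ≡⟨ cong ((f a + f′ a) * P +_) (lagrange-+ (λ i → f i * g i a) (λ i → f′ i * g i a) as) ⟩
    (f a + f′ a) * P + (lagrange (λ i → f i * g i a) as + lagrange (λ i → f′ i * g i a) as)
      ≡⟨ lemma (f a) (f′ a) P _ _ ⟩
    (f a * P + lagrange (λ i → f i * g i a) as) + (f′ a * P + lagrange (λ i → f′ i * g i a) as) ∎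
    where
    P = prodL (map (g a) as)
    lemma : ∀ x y p s t → (x + y) * p + (s + t) ≡ (x * p + s) + (y * p + t)
    lemma = solve-∀ ℚ-ring

  lagrange-*ˡ : ∀ c f L → lagrange (λ i → c * f i) L ≡ c * lagrange f L
  lagrange-*ˡ c f []       = sym (ℚ.*-zeroʳ c)
  lagrange-*ˡ c f (a ∷ as) = begin
    c * f a * P + lagrange (λ i → c * f i * g i a) as
      ≡⟨ cong (c * f a * P +_) (lagrange-cong (λ i → ℚ.*-assoc c (f i) (g i a)) as) ⟩
    c * f a * P + lagrange (λ i → c * (f i * g i a)) as
      ≡⟨ cong (c * f a * P +_) (lagrange-*ˡ c (λ i → f i * g i a) as) ⟩
    c * f a * P + c * lagrange (λ i → f i * g i a) as
      ≡⟨ lemma c (f a) P _ ⟩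
    c * (f a * P + lagrange (λ i → f i * g i a) as) ∎
    where
    P = prodL (map (g a) as)
    lemma : ∀ c x p s → c * x * p + c * s ≡ c * (x * p + s)
    lemma = solve-∀ ℚ-ring

  lagrange-*ʳ : ∀ c f L → lagrange (λ i → f i * c) L ≡ lagrange f L * c
  lagrange-*ʳ c f L = begin
    lagrange (λ i → f i * c) L  ≡⟨ lagrange-cong (λ i → ℚ.*-comm (f i) c) L ⟩
    lagrange (λ i → c * f i) L  ≡⟨ lagrange-*ˡ c f L ⟩
    c * lagrange f L            ≡⟨ ℚ.*-comm c (lagrange f L) ⟩
    lagrange f L * c            ∎

  lagrange-zero : ∀ L → lagrange (λ _ → 0ℚ) L ≡ 0ℚ
  lagrange-zero L = trans (lagrange-*ˡ 0ℚ (λ _ → 0ℚ) L) (ℚ.*-zeroˡ (lagrange (λ _ → 0ℚ) L))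

  module _ (Λ : Series → ℚ)
           (Λ-cong : ∀ {f f′} → f ≗ f′ → Λ f ≡ Λ f′)
           (Λ-+ : ∀ f f′ → Λ (λ k → f k + f′ k) ≡ Λ f + Λ f′)
           (Λ-* : ∀ c f → Λ (λ k → c * f k) ≡ c * Λ f) where

    lagrange-linear : ∀ L (F : ℕ → A → ℚ) → Λ (λ k → lagrange (F k) L) ≡ lagrange (λ i → Λ (λ k → F k i)) L
    -- λ k → 0ℚ * 0ℚ computes to λ _ → 0ℚ
    lagrange-linear []       F = trans (Λ-* 0ℚ (λ _ → 0ℚ)) (ℚ.*-zeroˡ (Λ (λ _ → 0ℚ)))
    lagrange-linear (a ∷ as) F = begin
      Λ (λ k → F k a * P + lagrange (λ i → F k i * g i a) as)
        ≡⟨ Λ-+ (λ k → F k a * P) (λ k → lagrange (λ i → F k i * g i a) as) ⟩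
      Λ (λ k → F k a * P) + Λ (λ k → lagrange (λ i → F k i * g i a) as)
        ≡⟨ cong₂ _+_ (Λ-*ʳ P (λ k → F k a)) (lagrange-linear as (λ k i → F k i * g i a)) ⟩
      Λ (λ k → F k a) * P + lagrange (λ i → Λ (λ k → F k i * g i a)) as
        ≡⟨ cong (Λ (λ k → F k a) * P +_) (lagrange-cong (λ i → Λ-*ʳ (g i a) (λ k → F k i)) as) ⟩
      Λ (λ k → F k a) * P + lagrange (λ i → Λ (λ k → F k i) * g i a) as ∎
      where
      P = prodL (map (g a) as)
      Λ-*ʳ : ∀ c f → Λ (λ k → f k * c) ≡ Λ f * c
      Λ-*ʳ c f = trans (Λ-cong (λ k → ℚ.*-comm (f k) c)) (trans (Λ-* c f) (ℚ.*-comm c (Λ f)))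

  sumTo-lagrange : ∀ n L (F : ℕ → A → ℚ) →
    sumTo n (λ r → lagrange (F r) L) ≡ lagrange (λ i → sumTo n (λ r → F r i)) L
  sumTo-lagrange n = lagrange-linear (sumTo n) (sumTo-cong n) (sumTo-+ n) (sumTo-*ˡ n)

  ⊛-lagrange : ∀ h n L (F : ℕ → A → ℚ) →
    (h ⊛ (λ k → lagrange (F k) L)) n ≡ lagrange (λ i → (h ⊛ (λ k → F k i)) n) L
  ⊛-lagrange h n = lagrange-linear (λ f → (h ⊛ f) n) (λ f≗f′ → ⊛-congʳ h f≗f′ n)
                                   (λ f f′ → ⊛-distribˡ-+ h f f′ n) (λ c f → ⊛-*ʳ c h f n)

  permSummand : (A → ℚ) → List A → ℚ
  permSummand f []       = 0ℚ
  permSummand f (i ∷ js) = f i * prodL (map (g i) js)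

  sumL-insertions-permSummand : ∀ f (a : A) q → sumL (map (permSummand f) (insertions a q))
    ≡ f a * prodL (map (g a) q) + ι (length q) * permSummand (λ i → f i * g i a) q
  sumL-insertions-permSummand f a []       = lemma (f a)
    where
    lemma : ∀ x → x * 1ℚ + 0ℚ ≡ x * 1ℚ + ι 0 * 0ℚ
    lemma = solve-∀ ℚ-ring
  sumL-insertions-permSummand f a (b ∷ bs) = begin
    X + sumL (map (permSummand f) (map (b ∷_) (insertions a bs)))
      ≡⟨ cong (λ s → X + sumL s) (sym (List.map-∘ (insertions a bs))) ⟩
    X + sumL (map (λ p → f b * prodL (map (g b) p)) (insertions a bs))
      ≡⟨ cong (X +_) (sumL-*ˡ (f b) (λ p → prodL (map (g b) p)) (insertions a bs)) ⟩
    X + f b * sumL (map (λ p → prodL (map (g b) p)) (insertions a bs))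
      ≡⟨ cong (λ s → X + f b * s) (sumL-insertions-prodL a bs (g b)) ⟩
    X + f b * (ι (suc (length bs)) * (g b a * prodL (map (g b) bs)))
      ≡⟨ cong (X +_) (lemma (f b) (ι (suc (length bs))) (g b a) (prodL (map (g b) bs))) ⟩
    X + ι (suc (length bs)) * (f b * g b a * prodL (map (g b) bs)) ∎
    where
    X = f a * prodL (map (g a) (b ∷ bs))
    lemma : ∀ y i z p → y * (i * (z * p)) ≡ i * (y * z * p)
    lemma = solve-∀ ℚ-ring

  sumL-perms-permSummand : ∀ f (a : A) as → sumL (map (permSummand f) (perms (a ∷ as)))
    ≡ ι (length as !) * (f a * prodL (map (g a) as)) + ι (length as) * sumL (map (permSummand (λ i → f i * g i a)) (perms as))
  sumL-perms-permSummand f a as = begin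
    sumL (map (permSummand f) (concatMap (insertions a) (perms as)))
      ≡⟨ sumL-map-concatMap (permSummand f) (insertions a) (perms as) ⟩
    sumL (map (λ q → sumL (map (permSummand f) (insertions a q))) (perms as))
      ≡⟨ cong sumL (List.map-cong (sumL-insertions-permSummand f a) (perms as)) ⟩
    sumL (map (λ q → f a * Π q + ι (length q) * ψ q) (perms as))
      ≡⟨ cong sumL (List.map-cong-local (All.map (λ {q} eq → cong (λ k → f a * Π q + ι k * ψ q) eq) (length-perms as))) ⟩
    sumL (map (λ q → f a * Π q + ι (length as) * ψ q) (perms as))
      ≡⟨ sumL-+ (λ q → f a * Π q) (λ q → ι (length as) * ψ q) (perms as) ⟩
    sumL (map (λ q → f a * Π q) (perms as)) + sumL (map (λ q → ι (length as) * ψ q) (perms as))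
      ≡⟨ cong₂ _+_ (sumL-*ˡ (f a) Π (perms as)) (sumL-*ˡ (ι (length as)) ψ (perms as)) ⟩
    f a * sumL (map Π (perms as)) + ι (length as) * sumL (map ψ (perms as))
      ≡⟨ cong (λ s → f a * s + ι (length as) * sumL (map ψ (perms as))) (sumL-perms-prodL as (g a)) ⟩
    f a * (ι (length as !) * Π as) + ι (length as) * sumL (map ψ (perms as))
      ≡⟨ cong (_+ ι (length as) * sumL (map ψ (perms as))) (lemma (f a) (ι (length as !)) (Π as)) ⟩
    ι (length as !) * (f a * Π as) + ι (length as) * sumL (map ψ (perms as)) ∎
    where
    Π = λ q → prodL (map (g a) q)
    ψ = permSummand (λ i → f i * g i a)
    lemma : ∀ x i p → x * (i * p) ≡ i * (x * p)
    lemma = solve-∀ ℚ-ring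

  sumL-perms≡lagrange : ∀ f (a : A) as → sumL (map (permSummand f) (perms (a ∷ as))) ≡ ι (length as !) * lagrange f (a ∷ as)
  sumL-perms≡lagrange f a []       = trans (sumL-perms-permSummand f a []) (lemma (f a))
    where
    lemma : ∀ x → ι 1 * (x * 1ℚ) + ι 0 * (0ℚ + 0ℚ) ≡ ι 1 * (x * 1ℚ + 0ℚ)
    lemma = solve-∀ ℚ-ring
  sumL-perms≡lagrange f a (b ∷ bs) = begin
    sumL (map (permSummand f) (perms (a ∷ b ∷ bs)))
      ≡⟨ sumL-perms-permSummand f a (b ∷ bs) ⟩
    ι (k !) * X + ι k * sumL (map (permSummand f′) (perms (b ∷ bs)))
      ≡⟨ cong (λ s → ι (k !) * X + ι k * s) (sumL-perms≡lagrange f′ b bs) ⟩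
    ι (k !) * X + ι k * (ι (length bs !) * Y)
      ≡⟨ cong (λ s → s * X + ι k * (ι (length bs !) * Y)) (ι-* k (length bs !)) ⟩
    ι k * ι (length bs !) * X + ι k * (ι (length bs !) * Y)
      ≡⟨ lemma (ι k) (ι (length bs !)) X Y ⟩
    ι k * ι (length bs !) * (X + Y)
      ≡⟨ cong (_* (X + Y)) (sym (ι-* k (length bs !))) ⟩
    ι (k !) * (X + Y) ∎
    where
    k = suc (length bs)
    f′ = λ i → f i * g i a
    X = f a * prodL (map (g a) (b ∷ bs))
    Y = lagrange f′ (b ∷ bs)
    lemma : ∀ i j x y → i * j * x + i * (j * y) ≡ i * j * (x + y)
    lemma = solve-∀ ℚ-ring

-- Partial fractions

module _ {A : Set} (x : A → ℚ) where
  open Lagrange (λ i j → cayley (x i) (x j))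

  Distinct : List A → Set
  Distinct = AllPairs (λ i j → x i ≢ x j)

  prodL-cayley : ∀ L → Distinct L → ∀ v → All (λ j → v ≢ x j) L →
    prodL (map (λ j → cayley v (x j)) L) ≡ 1ℚ + lagrange (λ j → pole v (x j)) L
  prodL-cayley []       _                  v _             = sym (ℚ.+-identityʳ 1ℚ)
  prodL-cayley (a ∷ as) (a≢as ∷ distinct) v (v≢a ∷ v≢as) = begin
    p * prodL (map (λ j → cayley v (x j)) as)
      ≡⟨ cong (p *_) (prodL-cayley as distinct v v≢as) ⟩
    p * (1ℚ + lagrange (c v) as)
      ≡⟨ lemma₁ p (lagrange (c v) as) ⟩
    p + p * lagrange (c v) as
      ≡⟨ cong (p +_) (sym (lagrange-*ˡ p (c v) as)) ⟩
    p + lagrange (λ i → p * c v i) as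
      ≡⟨ cong (p +_) (lagrange-cong-local as
           (All.zipWith (λ (v≢i , a≢i) → cayley-*-pole v≢a v≢i a≢i) (v≢as , a≢as))) ⟩
    p + lagrange (λ i → c v a * c (x a) i + c v i * cayley (x i) (x a)) as
      ≡⟨ cong (p +_) (lagrange-+ (λ i → c v a * c (x a) i) (λ i → c v i * cayley (x i) (x a)) as) ⟩
    p + (lagrange (λ i → c v a * c (x a) i) as + R)
      ≡⟨ cong₂ (λ s t → s + (t + R)) (cayley≡1+pole v≢a) (lagrange-*ˡ (c v a) (c (x a)) as) ⟩
    (1ℚ + c v a) + (c v a * lagrange (c (x a)) as + R)
      ≡⟨ lemma₂ (c v a) (lagrange (c (x a)) as) R ⟩
    1ℚ + (c v a * (1ℚ + lagrange (c (x a)) as) + R)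
      ≡⟨ cong (λ s → 1ℚ + (c v a * s + R)) (sym (prodL-cayley as distinct (x a) a≢as)) ⟩
    1ℚ + (c v a * prodL (map (λ j → cayley (x a) (x j)) as) + R) ∎
    where
    p = cayley v (x a)
    c = λ w j → pole w (x j)
    R = lagrange (λ i → c v i * cayley (x i) (x a)) as
    lemma₁ : ∀ p s → p * (1ℚ + s) ≡ p + p * s
    lemma₁ = solve-∀ ℚ-ring
    lemma₂ : ∀ c s t → (1ℚ + c) + (c * s + t) ≡ 1ℚ + (c * (1ℚ + s) + t)
    lemma₂ = solve-∀ ℚ-ring

  prodS-factorS : ∀ L → Distinct L → ∀ n →
    prodS (map (λ i → factorS (x i)) L) n ≡ oneS n + ι 2 * lagrange (λ i → poleS (x i) n) L
  prodS-factorS []       _                 n = sym (trans (cong (oneS n +_) (ℚ.*-zeroʳ (ι 2))) (ℚ.+-identityʳ (oneS n)))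
  prodS-factorS (a ∷ as) (a≢as ∷ distinct) n = begin
    (F ⊛ prodS (map (λ i → factorS (x i)) as)) n
      ≡⟨ ⊛-congʳ F (prodS-factorS as distinct) n ⟩
    (F ⊛ (λ k → oneS k + ι 2 * lagrange (J k) as)) n
      ≡⟨ ⊛-distribˡ-+ F oneS (λ k → ι 2 * lagrange (J k) as) n ⟩
    (F ⊛ oneS) n + (F ⊛ (λ k → ι 2 * lagrange (J k) as)) n
      ≡⟨ cong₂ _+_ (⊛-identityʳ F n) (⊛-*ʳ (ι 2) F (λ k → lagrange (J k) as) n) ⟩
    F n + ι 2 * (F ⊛ (λ k → lagrange (J k) as)) n
      ≡⟨ cong₂ (λ s t → s + ι 2 * t) (factorS≡1+2poleS (x a) n) (⊛-lagrange F n as J) ⟩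
    oneS n + ι 2 * J n a + ι 2 * lagrange (λ i → (F ⊛ poleS (x i)) n) as
      ≡⟨ cong (λ s → oneS n + ι 2 * J n a + ι 2 * s)
              (lagrange-cong-local as (All.map (λ a≢i → factorS-⊛-poleS a≢i n) a≢as)) ⟩
    oneS n + ι 2 * J n a + ι 2 * lagrange (λ i → cayley (x i) (x a) * J n i + pole (x a) (x i) * J n a) as
      ≡⟨ cong (λ s → oneS n + ι 2 * J n a + ι 2 * s)
              (lagrange-+ (λ i → cayley (x i) (x a) * J n i) (λ i → pole (x a) (x i) * J n a) as) ⟩
    oneS n + ι 2 * J n a + ι 2 * (lagrange (λ i → cayley (x i) (x a) * J n i) as + lagrange (λ i → pole (x a) (x i) * J n a) as)
      ≡⟨ cong₂ (λ s t → oneS n + ι 2 * J n a + ι 2 * (s + t))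
               (lagrange-cong (λ i → ℚ.*-comm (cayley (x i) (x a)) (J n i)) as)
               (lagrange-*ʳ (J n a) (λ i → pole (x a) (x i)) as) ⟩
    oneS n + ι 2 * J n a + ι 2 * (R + lagrange (λ i → pole (x a) (x i)) as * J n a)
      ≡⟨ lemma (oneS n) (J n a) R (lagrange (λ i → pole (x a) (x i)) as) ⟩
    oneS n + ι 2 * (J n a * (1ℚ + lagrange (λ i → pole (x a) (x i)) as) + R)
      ≡⟨ cong (λ s → oneS n + ι 2 * (J n a * s + R)) (sym (prodL-cayley as distinct (x a) a≢as)) ⟩
    oneS n + ι 2 * (J n a * prodL (map (λ j → cayley (x a) (x j)) as) + R) ∎
    where
    F = factorS (x a)
    J = λ k i → poleS (x i) k
    R = lagrange (λ i → J n i * cayley (x i) (x a)) as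
    lemma : ∀ o j r s → o + ι 2 * j + ι 2 * (r + s * j) ≡ o + ι 2 * (j * (1ℚ + s) + r)
    lemma = solve-∀ ℚ-ring

module _ {m : ℕ} (x : Fin (suc m) → ℚ) where
  open Lagrange (λ i j → cayley (x i) (x j))

  Pstar≡lagrange : ∀ r → Pstar (suc m) x r ≡ lagrange (λ i → fall (x i) r) (allFin (suc m))
  Pstar≡lagrange r = begin
    inv (ι (m !)) * sumL (map (permTerm x r) (perms (allFin (suc m))))
      ≡⟨ cong (λ s → inv (ι (m !)) * sumL s) (List.map-cong permTerm≗permSummand (perms (allFin (suc m)))) ⟩
    inv (ι (m !)) * sumL (map (permSummand f) (perms (Fin.zero ∷ tabulate Fin.suc)))
      ≡⟨ cong (inv (ι (m !)) *_) (sumL-perms≡lagrange f Fin.zero (tabulate Fin.suc)) ⟩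
    inv (ι (m !)) * (ι (length (tabulate {n = m} Fin.suc) !) * lagrange f (allFin (suc m)))
      ≡⟨ cong (λ k → inv (ι (m !)) * (ι (k !) * lagrange f (allFin (suc m)))) (List.length-tabulate {n = m} Fin.suc) ⟩
    inv (ι (m !)) * (ι (m !) * lagrange f (allFin (suc m)))
      ≡⟨ inv-cancelˡ (lagrange f (allFin (suc m))) (ι-!≢0 m) ⟩
    lagrange f (allFin (suc m)) ∎
    where
    f = λ i → fall (x i) r
    permTerm≗permSummand : permTerm x r ≗ permSummand f
    permTerm≗permSummand []       = refl
    permTerm≗permSummand (_ ∷ _) = refl

  lhsS≡lagrange : ∀ n → lhsS (suc m) x n ≡ oneS n + ι 2 * lagrange (λ i → poleS (x i) n) (allFin (suc m))
  lhsS≡lagrange zero    = begin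
    1ℚ * invFallS 0 0     ≡⟨ cong (1ℚ *_) (invFallS-zero 0) ⟩
    1ℚ * 1ℚ               ≡⟨⟩
    1ℚ + ι 2 * 0ℚ         ≡⟨ cong (λ s → 1ℚ + ι 2 * s) (sym (lagrange-zero (allFin (suc m)))) ⟩
    1ℚ + ι 2 * lagrange (λ _ → 0ℚ) (allFin (suc m)) ∎
  lhsS≡lagrange (suc n) = begin
    lhsS (suc m) x (suc n)
      ≡⟨ sumTo-peel n (λ r → Qstar (suc m) x r * invFallS r (suc n)) ⟩
    1ℚ * invFallS 0 (suc n) + sumTo n (λ r → ι 2 * Pstar (suc m) x (suc r) * invFallS (suc r) (suc n))
      ≡⟨ cong₂ (λ s t → 1ℚ * s + t) (invFallS-zero (suc n)) (sumTo-cong n term) ⟩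
    0ℚ + sumTo n (λ r → ι 2 * lagrange (F r) L)
      ≡⟨ cong (0ℚ +_) (sumTo-*ˡ n (ι 2) (λ r → lagrange (F r) L)) ⟩
    0ℚ + ι 2 * sumTo n (λ r → lagrange (F r) L)
      ≡⟨ cong (λ s → 0ℚ + ι 2 * s) (sumTo-lagrange n L F) ⟩
    0ℚ + ι 2 * lagrange (λ i → sumTo n (λ r → F r i)) L
      ≡⟨ cong (λ s → 0ℚ + ι 2 * s) (lagrange-cong (λ i → newtonS-tail (x i) n) L) ⟩
    0ℚ + ι 2 * lagrange (λ i → poleS (x i) (suc n)) L ∎
    where
    L = allFin (suc m)
    F = λ r i → fall (x i) (suc r) * invFallS (suc r) (suc n)
    term : ∀ r → ι 2 * Pstar (suc m) x (suc r) * invFallS (suc r) (suc n) ≡ ι 2 * lagrange (F r) L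
    term r = begin
      ι 2 * Pstar (suc m) x (suc r) * invFallS (suc r) (suc n)
        ≡⟨ cong (λ s → ι 2 * s * invFallS (suc r) (suc n)) (Pstar≡lagrange (suc r)) ⟩
      ι 2 * lagrange (λ i → fall (x i) (suc r)) L * invFallS (suc r) (suc n)
        ≡⟨ ℚ.*-assoc (ι 2) (lagrange (λ i → fall (x i) (suc r)) L) (invFallS (suc r) (suc n)) ⟩
      ι 2 * (lagrange (λ i → fall (x i) (suc r)) L * invFallS (suc r) (suc n))
        ≡⟨ cong (ι 2 *_) (sym (lagrange-*ʳ (invFallS (suc r) (suc n)) (λ i → fall (x i) (suc r)) L)) ⟩
      ι 2 * lagrange (F r) L ∎

corollary8p3 : (n : ℕ) → 1 ≤ n → (x : Fin n → ℚ) →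
    (∀ i j → i ≢ j → x i ≢ x j) →
    (N : ℕ) → lhsS n x N ≡ rhsS n x N
corollary8p3 (suc m) _ x x-injective N =
  trans (lhsS≡lagrange x N) (sym (prodS-factorS x (allFin (suc m)) distinct N))
  where
  distinct : Distinct x (allFin (suc m))
  distinct = AllPairs.map (λ {i} {j} → x-injective i j) (allFin⁺ (suc m))
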